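{- Let $G$ be a $\Gamma$-vertex-transitive graph, where $\Gamma$ is a subgroup of $\mathrm{Aut}(G)$. Let $\Lambda$ be a normal subgroup of $\Gamma$ which acts semiregularly on both $V(G)$ and $E(G)$, and let $\Lambda^{*}$ be the set of elements of $\Gamma$ which leave both $\Lambda(v)$ and $\Lambda(e)$ invariant for every $v\in V(G)$ and $e\in E(G)$ (a normal subgroup of $\Gamma$). If $\Lambda(v)$ is an independent set of $G$ for some $v\in V(G)$, then the regular quotient $G_\Lambda$ of $G$ induced by $\Lambda$ is $\Gamma/\Lambda^{*}$-vertex-transitive; that is, the rule $\gamma\Lambda^*(\Lambda(v))=\Lambda(\gamma(v))$, $\gamma\Lambda^*(\Lambda(e))=\Lambda(\gamma(e))$ defines a faithful action of $\Gamma/\Lambda^*$ as a subgroup of $\mathrm{Aut}(G_\Lambda)$ which is transitive on $V(G_\Lambda)$ (and $G_\Lambda$ has no loops).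
   Context: Graphs are finite, undirected, with parallel edges allowed; vertex-transitive graphs have no loops. An automorphism of $G$ is an incidence-preserving bijection of $V(G)\cup E(G)$ mapping vertices to vertices and edges to edges; $\mathrm{Aut}(G)$ is the group of these. $G$ is $\Gamma$-vertex-transitive if $\Gamma\le\mathrm{Aut}(G)$ is transitive on $V(G)$. A group acts semiregularly on a set if only the identity fixes any point. For $\Lambda\le\mathrm{Aut}(G)$, $\Lambda(v)$ and $\Lambda(e)$ denote the $\Lambda$-orbits of a vertex $v$ and an edge $e$. When $\Lambda$ acts semiregularly on both $V(G)$ and $E(G)$, the regular quotient $G_\Lambda$ is the graph with vertex set $\{\Lambda(v)\}$ and edge set $\{\Lambda(e)\}$, where $\Lambda(e)$ joins $\Lambda(x)$ and $\Lambda(y)$ if $e$ has end-vertices $x,y$. -}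

module Defs where

open import Data.Nat using (ℕ)
open import Data.Fin using (Fin)
open import Data.Product using (Σ; ∃; _×_; _,_; proj₁; proj₂)
open import Data.Sum using (_⊎_)
open import Relation.Binary.PropositionalEquality using (_≡_; _≢_)
open import Relation.Nullary using (¬_)
open import Function.Bundles using (_⇔_)

-- A finite undirected multigraph (loops allowed): vertices Fin nV, edges Fin nE,
-- each edge has an (unordered) pair of end-vertices, given in some order by 'ends'.
record Graph : Set where
  field
    nV   : ℕ
    nE   : ℕ
    ends : Fin nE → Fin nV × Fin nV
open Graph public

SamePair : {A : Set} → A × A → A × A → Set
SamePair (a , b) (c , d) = (a ≡ c × b ≡ d) ⊎ (a ≡ d × b ≡ c)

Loopless : Graph → Set
Loopless G = ∀ e → proj₁ (ends G e) ≢ proj₂ (ends G e)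

record Aut (G : Graph) : Set where
  field
    fV  : Fin (nV G) → Fin (nV G)
    gV  : Fin (nV G) → Fin (nV G)
    fgV : ∀ v → fV (gV v) ≡ v
    gfV : ∀ v → gV (fV v) ≡ v
    fE  : Fin (nE G) → Fin (nE G)
    gE  : Fin (nE G) → Fin (nE G)
    fgE : ∀ e → fE (gE e) ≡ e
    gfE : ∀ e → gE (fE e) ≡ e
    preserves : ∀ e → SamePair (ends G (fE e))
                               (fV (proj₁ (ends G e)) , fV (proj₂ (ends G e)))
open Aut public

_≈A_ : {G : Graph} → Aut G → Aut G → Set
σ ≈A τ = (∀ v → fV σ v ≡ fV τ v) × (∀ e → fE σ e ≡ fE τ e)

IsIdentity : {G : Graph} → Aut G → Set
IsIdentity σ = (∀ v → fV σ v ≡ v) × (∀ e → fE σ e ≡ e)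

record IsSubgroup (G : Graph) (P : Aut G → Set) : Set where
  field
    resp   : ∀ σ τ → σ ≈A τ → P σ → P τ
    has-id : Σ (Aut G) λ ρ → P ρ × IsIdentity ρ
    comp   : ∀ σ τ → P σ → P τ → Σ (Aut G) λ ρ → P ρ ×
               ((∀ v → fV ρ v ≡ fV σ (fV τ v)) × (∀ e → fE ρ e ≡ fE σ (fE τ e)))
    inv    : ∀ σ → P σ → Σ (Aut G) λ ρ → P ρ ×
               ((∀ v → fV ρ (fV σ v) ≡ v) × (∀ e → fE ρ (fE σ e) ≡ e))

-- Λ is a normal subgroup of Γ: Λ ≤ Γ and γ λ γ⁻¹ ∈ Λ for γ ∈ Γ, λ ∈ Λ
-- (expressed as: some ρ ∈ Λ with ρ ∘ γ = γ ∘ λ).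
record IsNormalSubgroup (G : Graph) (Γ Λ : Aut G → Set) : Set where
  field
    sub    : IsSubgroup G Λ
    incl   : ∀ σ → Λ σ → Γ σ
    normal : ∀ γ μ → Γ γ → Λ μ → Σ (Aut G) λ ρ → Λ ρ ×
               ((∀ v → fV ρ (fV γ v) ≡ fV γ (fV μ v)) ×
                (∀ e → fE ρ (fE γ e) ≡ fE γ (fE μ e)))

VertexTransitive : (G : Graph) → (Aut G → Set) → Set
VertexTransitive G Γ = ∀ v w → Σ (Aut G) λ γ → Γ γ × fV γ v ≡ w

SemiregularV : (G : Graph) → (Aut G → Set) → Set
SemiregularV G Λ = ∀ μ → Λ μ → ∀ v → fV μ v ≡ v → IsIdentity μ

SemiregularE : (G : Graph) → (Aut G → Set) → Set
SemiregularE G Λ = ∀ μ → Λ μ → ∀ e → fE μ e ≡ e → IsIdentity μ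

-- orbit relations: OrbV Λ x y  means  y ∈ Λ(x)
OrbV : {G : Graph} → (Aut G → Set) → Fin (nV G) → Fin (nV G) → Set
OrbV Λ x y = Σ _ λ μ → Λ μ × fV μ x ≡ y

OrbE : {G : Graph} → (Aut G → Set) → Fin (nE G) → Fin (nE G) → Set
OrbE Λ e f = Σ _ λ μ → Λ μ × fE μ e ≡ f

IndependentOrbit : (G : Graph) → (Aut G → Set) → Fin (nV G) → Set
IndependentOrbit G Λ v =
  ∀ e → ¬ (OrbV Λ v (proj₁ (ends G e)) × OrbV Λ v (proj₂ (ends G e)))

-- Λ* : elements of Γ leaving every Λ(v) and every Λ(e) setwise invariant
-- (for a bijection γ: γ(S) = S  iff  ∀ w, w ∈ S ⇔ γ w ∈ S).
LambdaStar : {G : Graph} → (Γ Λ : Aut G → Set) → Aut G → Set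
LambdaStar {G} Γ Λ γ =
  Γ γ ×
  ((∀ v w → OrbV Λ v w ⇔ OrbV Λ v (fV γ w)) ×
   (∀ e f → OrbE Λ e f ⇔ OrbE Λ e (fE γ f)))

-- H together with projections π is (a presentation of) the regular quotient G_Λ:
-- vertices of H are exactly the Λ-orbits on V(G), edges of H exactly the Λ-orbits
-- on E(G), and the edge Λ(e) joins Λ(x) and Λ(y) where x, y are the ends of e.
record IsRegularQuotient (G : Graph) (Λ : Aut G → Set) (H : Graph) : Set where
  field
    πV      : Fin (nV G) → Fin (nV H)
    πE      : Fin (nE G) → Fin (nE H)
    πV-surj : ∀ a → Σ (Fin (nV G)) λ v → πV v ≡ a
    πE-surj : ∀ a → Σ (Fin (nE G)) λ e → πE e ≡ a
    πV-orb  : ∀ x y → (πV x ≡ πV y) ⇔ OrbV Λ x y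
    πE-orb  : ∀ e f → (πE e ≡ πE f) ⇔ OrbE Λ e f
    π-ends  : ∀ e → SamePair (ends H (πE e))
                             (πV (proj₁ (ends G e)) , πV (proj₂ (ends G e)))
open IsRegularQuotient public

{-# OPTIONS --safe #-}

-- Since Λ is normal in Γ, every γ ∈ Γ maps Λ-orbits of vertices and of edges onto
-- Λ-orbits, so γ descends along the orbit projections to an automorphism of G_Λ.
-- The descended map is the identity exactly when γ fixes every orbit, i.e. γ ∈ Λ*,
-- and transitivity of Γ on V(G) is inherited by the quotient. If an edge joined two
-- vertices of one Λ-orbit, translating it by Γ would give an edge inside Λ(v), so the
-- independence of the single orbit Λ(v) makes all orbits independent: G_Λ has no loops.
module Submission where

open import Defs
open import Data.Fin using (Fin)
open import Data.Product using (Σ; _×_; _,_; proj₁; proj₂)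
open import Data.Product.Function.NonDependent.Propositional using (_×-⇔_)
open import Data.Sum using (inj₁; inj₂)
open import Relation.Binary.PropositionalEquality
  using (_≡_; refl; sym; trans; cong; subst; subst₂; module ≡-Reasoning)
open import Function.Bundles using (_⇔_; mk⇔; Equivalence)
open import Function.Construct.Composition using (_⇔-∘_)
open import Function.Construct.Symmetry using (⇔-sym)
open import Relation.Nullary using (¬_)

open Equivalence

SamePair-sym : {A : Set} {p q : A × A} → SamePair p q → SamePair q p
SamePair-sym (inj₁ (a , b)) = inj₁ (sym a , sym b)
SamePair-sym (inj₂ (a , b)) = inj₂ (sym b , sym a)

SamePair-trans : {A : Set} {p q r : A × A} → SamePair p q → SamePair q r → SamePair p r
SamePair-trans (inj₁ (a , b)) (inj₁ (c , d)) = inj₁ (trans a c , trans b d)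
SamePair-trans (inj₁ (a , b)) (inj₂ (c , d)) = inj₂ (trans a c , trans b d)
SamePair-trans (inj₂ (a , b)) (inj₁ (c , d)) = inj₂ (trans a d , trans b c)
SamePair-trans (inj₂ (a , b)) (inj₂ (c , d)) = inj₁ (trans a d , trans b c)

SamePair-map : {A B : Set} (f : A → B) {p q : A × A} → SamePair p q →
  SamePair (f (proj₁ p) , f (proj₂ p)) (f (proj₁ q) , f (proj₂ q))
SamePair-map f (inj₁ (a , b)) = inj₁ (cong f a , cong f b)
SamePair-map f (inj₂ (a , b)) = inj₂ (cong f a , cong f b)

SamePair-respʳ : {A : Set} {p : A × A} {a b a′ b′ : A} →
  a ≡ a′ → b ≡ b′ → SamePair p (a , b) → SamePair p (a′ , b′)
SamePair-respʳ refl refl s = s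

SamePair-coincident : {A : Set} {p : A × A} {a b : A} →
  SamePair p (a , b) → proj₁ p ≡ proj₂ p → a ≡ b
SamePair-coincident (inj₁ (c , d)) eq = trans (sym c) (trans eq d)
SamePair-coincident (inj₂ (c , d)) eq = trans (sym d) (trans (sym eq) c)

SamePair-both : {A : Set} (P : A → Set) {p q : A × A} → SamePair p q →
  P (proj₁ q) × P (proj₂ q) → P (proj₁ p) × P (proj₂ p)
SamePair-both P (inj₁ (c , d)) (x , y) =
  subst P (sym c) x , subst P (sym d) y
SamePair-both P (inj₂ (c , d)) (x , y) =
  subst P (sym c) y , subst P (sym d) x

module Descent {A B : Set} (π : A → B) (π-surj : ∀ b → Σ A λ a → π a ≡ b) where

  section : B → A
  section b = proj₁ (π-surj b)

  π-section : ∀ b → π (section b) ≡ b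
  π-section b = proj₂ (π-surj b)

  Respects : (A → A) → Set
  Respects f = ∀ {x y} → π x ≡ π y → π (f x) ≡ π (f y)

  descend : (A → A) → B → B
  descend f b = π (f (section b))

  descend-π : ∀ {f} → Respects f → ∀ x → descend f (π x) ≡ π (f x)
  descend-π resp x = resp (π-section (π x))

  descend-inverse : ∀ {f g} → Respects f → (∀ x → f (g x) ≡ x) →
    ∀ b → descend f (descend g b) ≡ b
  descend-inverse {f} {g} resp fg b = begin
    descend f (π (g (section b))) ≡⟨ descend-π resp _ ⟩
    π (f (g (section b)))         ≡⟨ cong π (fg _) ⟩
    π (section b)                 ≡⟨ π-section b ⟩
    b                             ∎
    where open ≡-Reasoning

  descend-identity⇔ : ∀ {f} → Respects f →
    (∀ b → descend f b ≡ b) ⇔ (∀ x → π (f x) ≡ π x)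
  descend-identity⇔ resp = mk⇔
    (λ id x → trans (sym (descend-π resp x)) (id (π x)))
    (λ fixes b → trans (fixes (section b)) (π-section b))

  fixesFibres⇔ : {R : A → A → Set} → (∀ x y → (π x ≡ π y) ⇔ R x y) → (f : A → A) →
    (∀ v w → R v w ⇔ R v (f w)) ⇔ (∀ x → π (f x) ≡ π x)
  fixesFibres⇔ kernel f = mk⇔
    (λ h x → sym (from (kernel _ _) (to (h x x) (to (kernel x x) refl))))
    (λ fixes v w → mk⇔
      (λ r → to (kernel _ _) (trans (from (kernel _ _) r) (sym (fixes w))))
      (λ r → to (kernel _ _) (trans (from (kernel _ _) r) (fixes w))))

inverse-fV : {G : Graph} {γ ρ : Aut G} →
  (∀ v → fV ρ (fV γ v) ≡ v) → ∀ v → fV ρ v ≡ gV γ v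
inverse-fV {γ = γ} {ρ} ργ v = trans (cong (fV ρ) (sym (fgV γ v))) (ργ (gV γ v))

inverse-fE : {G : Graph} {γ ρ : Aut G} →
  (∀ e → fE ρ (fE γ e) ≡ e) → ∀ e → fE ρ e ≡ gE γ e
inverse-fE {γ = γ} {ρ} ργ e = trans (cong (fE ρ) (sym (fgE γ e))) (ργ (gE γ e))

module Orbits {G : Graph} {Γ Λ : Aut G → Set}
    (SG : IsSubgroup G Γ) (NS : IsNormalSubgroup G Γ Λ) where

  open IsNormalSubgroup NS

  OrbV-refl : ∀ x → OrbV Λ x x
  OrbV-refl x with IsSubgroup.has-id sub
  ... | ι , i , ιv , _ = ι , i , ιv x

  OrbV-image : ∀ {γ x y} → Γ γ → OrbV Λ x y → OrbV Λ (fV γ x) (fV γ y)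
  OrbV-image {γ} {x} p (μ , m , refl) with normal γ μ p m
  ... | ρ , r , ρv , _ = ρ , r , ρv x

  OrbE-image : ∀ {γ e f} → Γ γ → OrbE Λ e f → OrbE Λ (fE γ e) (fE γ f)
  OrbE-image {γ} {e} p (μ , m , refl) with normal γ μ p m
  ... | ρ , r , _ , ρe = ρ , r , ρe e

  OrbV-preimage : ∀ {γ x y} → Γ γ → OrbV Λ x y → OrbV Λ (gV γ x) (gV γ y)
  OrbV-preimage {γ} p o with IsSubgroup.inv SG γ p
  ... | ρ , r , ργ , _ =
    subst₂ (OrbV Λ) (inverse-fV {γ = γ} {ρ} ργ _) (inverse-fV {γ = γ} {ρ} ργ _) (OrbV-image r o)

  OrbE-preimage : ∀ {γ e f} → Γ γ → OrbE Λ e f → OrbE Λ (gE γ e) (gE γ f)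
  OrbE-preimage {γ} p o with IsSubgroup.inv SG γ p
  ... | ρ , r , _ , ργ =
    subst₂ (OrbE Λ) (inverse-fE {γ = γ} {ρ} ργ _) (inverse-fE {γ = γ} {ρ} ργ _) (OrbE-image r o)

  no-edge-within-orbit : VertexTransitive G Γ → ∀ {v} → IndependentOrbit G Λ v →
    ∀ e → ¬ OrbV Λ (proj₁ (ends G e)) (proj₂ (ends G e))
  no-edge-within-orbit VT {v} indep e o with VT (proj₁ (ends G e)) v
  ... | γ , p , γx≡v = indep (fE γ e)
    (SamePair-both (OrbV Λ v) (preserves γ e)
      ( subst (OrbV Λ v) (sym γx≡v) (OrbV-refl v)
      , subst (λ z → OrbV Λ z _) γx≡v (OrbV-image p o)))

module Quotient {G : Graph} {Γ Λ : Aut G → Set}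
    (SG : IsSubgroup G Γ) (NS : IsNormalSubgroup G Γ Λ)
    {H : Graph} (Q : IsRegularQuotient G Λ H) where

  open Orbits SG NS
  module DV = Descent (πV Q) (πV-surj Q)
  module DE = Descent (πE Q) (πE-surj Q)

  OrbV-respects : ∀ {f} → (∀ {x y} → OrbV Λ x y → OrbV Λ (f x) (f y)) → DV.Respects f
  OrbV-respects image eq = from (πV-orb Q _ _) (image (to (πV-orb Q _ _) eq))

  OrbE-respects : ∀ {f} → (∀ {e e′} → OrbE Λ e e′ → OrbE Λ (f e) (f e′)) → DE.Respects f
  OrbE-respects image eq = from (πE-orb Q _ _) (image (to (πE-orb Q _ _) eq))

  ends-section : ∀ a → SamePair (ends H a)
    (πV Q (proj₁ (ends G (DE.section a))) , πV Q (proj₂ (ends G (DE.section a))))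
  ends-section a = subst (λ b → SamePair (ends H b) (πV Q x , πV Q y))
    (DE.π-section a) (π-ends Q e)
    where
    e = DE.section a
    x = proj₁ (ends G e)
    y = proj₂ (ends G e)

  module _ (γ : Aut G) (p : Γ γ) where

    respectsV : DV.Respects (fV γ)
    respectsV = OrbV-respects (OrbV-image p)

    respectsE : DE.Respects (fE γ)
    respectsE = OrbE-respects (OrbE-image p)

    descend-preserves : ∀ a → SamePair (ends H (DE.descend (fE γ) a))
      (DV.descend (fV γ) (proj₁ (ends H a)) , DV.descend (fV γ) (proj₂ (ends H a)))
    descend-preserves a =
      SamePair-trans (π-ends Q (fE γ e))
        (SamePair-trans (SamePair-map (πV Q) (preserves γ e))
          (SamePair-sym
            (SamePair-respʳ (DV.descend-π respectsV _) (DV.descend-π respectsV _)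
              (SamePair-map (DV.descend (fV γ)) (ends-section a)))))
      where e = DE.section a

    quotientAut : Aut H
    quotientAut = record
      { fV = DV.descend (fV γ)
      ; gV = DV.descend (gV γ)
      ; fgV = DV.descend-inverse respectsV (fgV γ)
      ; gfV = DV.descend-inverse (OrbV-respects (OrbV-preimage p)) (gfV γ)
      ; fE = DE.descend (fE γ)
      ; gE = DE.descend (gE γ)
      ; fgE = DE.descend-inverse respectsE (fgE γ)
      ; gfE = DE.descend-inverse (OrbE-respects (OrbE-preimage p)) (gfE γ)
      ; preserves = descend-preserves
      }

    quotientAut-identity⇔ : IsIdentity quotientAut ⇔ LambdaStar Γ Λ γ
    quotientAut-identity⇔ = mk⇔ (p ,_) proj₂ ⇔-∘ (fixesV ×-⇔ fixesE)
      where
      fixesV : (∀ a → DV.descend (fV γ) a ≡ a) ⇔ (∀ v w → OrbV Λ v w ⇔ OrbV Λ v (fV γ w))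
      fixesV = ⇔-sym (DV.fixesFibres⇔ (πV-orb Q) (fV γ)) ⇔-∘ DV.descend-identity⇔ respectsV
      fixesE : (∀ a → DE.descend (fE γ) a ≡ a) ⇔ (∀ e f → OrbE Λ e f ⇔ OrbE Λ e (fE γ f))
      fixesE = ⇔-sym (DE.fixesFibres⇔ (πE-orb Q) (fE γ)) ⇔-∘ DE.descend-identity⇔ respectsE

  quotientAut-transitive : VertexTransitive G Γ →
    ∀ a b → Σ (Aut G) λ γ → Σ (Γ γ) λ p → fV (quotientAut γ p) a ≡ b
  quotientAut-transitive VT a b with VT (DV.section a) (DV.section b)
  ... | γ , p , γa≡b = γ , p , trans (cong (πV Q) γa≡b) (DV.π-section b)

  quotient-loopless : VertexTransitive G Γ → ∀ {v} → IndependentOrbit G Λ v → Loopless H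
  quotient-loopless VT indep a loop = no-edge-within-orbit VT indep (DE.section a)
    (to (πV-orb Q _ _) (SamePair-coincident (ends-section a) loop))

lemma3p3 : (G : Graph) (Γ Λ : Aut G → Set)
    → IsSubgroup G Γ
    → VertexTransitive G Γ
    → Loopless G
    → IsNormalSubgroup G Γ Λ
    → SemiregularV G Λ
    → SemiregularE G Λ
    → Σ (Fin (nV G)) (λ v → IndependentOrbit G Λ v)
    → (H : Graph) → (Q : IsRegularQuotient G Λ H)
    → Σ ((γ : Aut G) → Γ γ → Aut H) λ φ →
        ((∀ γ (p : Γ γ) v → fV (φ γ p) (πV Q v) ≡ πV Q (fV γ v)) ×
         (∀ γ (p : Γ γ) e → fE (φ γ p) (πE Q e) ≡ πE Q (fE γ e))) ×
        (∀ γ (p : Γ γ) → IsIdentity (φ γ p) ⇔ LambdaStar Γ Λ γ) ×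
        (∀ a b → Σ (Aut G) λ γ → Σ (Γ γ) λ p → fV (φ γ p) a ≡ b) ×
        Loopless H
-- Semiregularity of Λ and looplessness of G only serve to make the regular quotient
-- exist; here it is given as H together with Q.
lemma3p3 G Γ Λ SG VT _ NS _ _ (_ , indep) H Q =
  quotientAut ,
  ((λ γ p → DV.descend-π (respectsV γ p)) , (λ γ p → DE.descend-π (respectsE γ p))) ,
  quotientAut-identity⇔ ,
  quotientAut-transitive VT ,
  quotient-loopless VT indep
  where open Quotient SG NS Q
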